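{- Let $z_1=(x_1,y_1)$ and $z_2=(x_2,y_2)$ be distinct points of $\mathbb{Z}^2$ with $x_2-x_1\ge|y_2-y_1|$, so that $d^{\star}(z_1,z_2)=x_2-x_1$. Let $d\ge d^{\star}(z_1,z_2)$ be an integer, $c=d-d^{\star}(z_1,z_2)$, and let ${\cal A}^{\star}_d(z_1,z_2)$ be the optimal tristance anticode in ${\cal G}^{\star}_2$ of diameter $d$ centered about $z_1$ and $z_2$. Then ${\cal A}^{\star}_d(z_1,z_2)$ consists of all $(x,y)\in\mathbb{Z}^2$ such that $x_1-c\le x\le x_2+c$, $x_1+y_1-2c\le x+y\le x_2+y_2+2c$, $x_1-y_1-2c\le x-y\le x_2-y_2+2c$, $(x_1+y_1)-(x_2-y_2)-2c\le 2y\le (x_2+y_2)-(x_1-y_1)+2c$.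
   Context: The infinity graph ${\cal G}^{\star}_2$ has vertex set $\mathbb{Z}^2$, with $(x,y)$ and $(x',y')$ adjacent iff $d^{\star}((x,y),(x',y'))=\max\{|x-x'|,|y-y'|\}=1$. For $z_1,z_2,z_3\in\mathbb{Z}^2$, the tristance $d^{\star}_3(z_1,z_2,z_3)$ is the minimum number of edges of a tree in ${\cal G}^{\star}_2$ (possibly using additional vertices) containing $z_1,z_2,z_3$. A set ${\cal A}\subset\mathbb{Z}^2$ is a tristance anticode of diameter $d$ centered about $z_1,z_2$ if $d^{\star}_3(z_1,z_2,z)\le d$ for all $z\in{\cal A}$; it is optimal if it has largest possible cardinality among such sets. -}

module Defs where

open import Data.Nat using (ℕ; zero; suc; _⊔_; _≤_)
open import Data.Integer using (ℤ; +_; _-_; ∣_∣)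
open import Data.Product using (_×_; _,_; ∃-syntax)
open import Data.List using (List; _∷_; [])
open import Data.List.Membership.Propositional using (_∈_; _∉_)
open import Relation.Binary.PropositionalEquality using (_≡_)

ℤ² : Set
ℤ² = ℤ × ℤ

d⋆ : ℤ² → ℤ² → ℕ
d⋆ (x , y) (x' , y') = ∣ x - x' ∣ ⊔ ∣ y - y' ∣

Adj : ℤ² → ℤ² → Set
Adj z z' = d⋆ z z' ≡ 1

-- Finite trees in G*_2: TreeIn V k means there is a tree (subgraph of G*_2)
-- with vertex list V and exactly k edges.
data TreeIn : List ℤ² → ℕ → Set where
  single : (v : ℤ²) → TreeIn (v ∷ []) 0
  grow   : ∀ {V k} → TreeIn V k → (u v : ℤ²) → u ∈ V → v ∉ V → Adj u v →
           TreeIn (v ∷ V) (suc k)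

-- d*_3(z1,z2,z3) ≤ d : some tree of G*_2 with at most d edges contains z1,z2,z3
-- (the tristance is the minimum such number of edges).
Tristance≤ : ℕ → ℤ² → ℤ² → ℤ² → Set
Tristance≤ d z₁ z₂ z₃ =
  ∃[ V ] ∃[ k ] (TreeIn V k × k ≤ d × z₁ ∈ V × z₂ ∈ V × z₃ ∈ V)

IsTristanceAnticode : ℕ → ℤ² → ℤ² → (ℤ² → Set) → Set
IsTristanceAnticode d z₁ z₂ A = ∀ z → A z → Tristance≤ d z₁ z₂ z

module Submission where

-- A tree of G⋆₂ with k edges through z₁, z₂, z₃ yields a centre m with
-- d⋆(m,z₁) + d⋆(m,z₂) + d⋆(m,z₃) ≤ k: by induction on the tree, a new leaf v next
-- to u costs one edge, and m has to move (to v) only when v is two of the three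
-- points.  Conversely king paths from m to the three points form such a tree.
-- So z is in the anticode iff some m = (p, q) has star length ≤ c + (x₂ − x₁).
-- Every octagon inequality is a nonnegative combination of the bounds
-- ±(p − xᵢ), ±(q − yᵢ) ≤ d⋆(m, zᵢ).  Conversely, for z in the octagon a centre on a
-- geodesic from z₁ to z₂ within distance c of z exists: the constraints on (p, q)
-- are linear, and Fourier–Motzkin elimination (of q, then of p) leaves exactly the
-- octagon inequalities, c ≥ 0 and |y₂ − y₁| ≤ x₂ − x₁.

open import Defs

module Steiner where

  open import Data.Nat using (ℕ; zero; suc; _+_; _⊔_; _⊓_; _∸_; _≤_; z≤n; s≤s)
  open import Data.Nat.Properties
  open import Data.Integer as ℤ using (ℤ; +_; -[1+_]; 0ℤ; 1ℤ; -1ℤ; ∣_∣)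
  import Data.Integer.Properties as ℤₚ
  open import Data.Integer.Tactic.RingSolver using (solve-∀)
  import Data.Nat.Tactic.RingSolver as ℕ-Solver
  open import Data.Product using (_,_; ∃-syntax; map₂)
  open import Data.Product.Properties using (≡-dec)
  open import Data.List using (List; _∷_; [])
  open import Data.List.Membership.Propositional using (_∈_)
  open import Data.List.Relation.Binary.Subset.Propositional using (_⊆_)
  open import Data.List.Relation.Unary.Any using (here; there)
  open import Function.Base using (id; _∘_)
  open import Function.Bundles using (_⇔_; mk⇔)
  open import Relation.Nullary using (yes; no)
  open import Relation.Binary.PropositionalEquality

  open import Data.List.Membership.DecPropositional (≡-dec ℤ._≟_ ℤ._≟_) using (_∈?_)

  d⋆-self : ∀ z → d⋆ z z ≡ 0
  d⋆-self (x , y) rewrite ℤₚ.+-inverseʳ x | ℤₚ.+-inverseʳ y = refl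

  d⋆-sym : ∀ z w → d⋆ z w ≡ d⋆ w z
  d⋆-sym (x , y) (x' , y') rewrite ℤₚ.∣i-j∣≡∣j-i∣ x x' | ℤₚ.∣i-j∣≡∣j-i∣ y y' = refl

  ∣i-k∣≤∣i-j∣+∣j-k∣ : ∀ i j k → ∣ i ℤ.- k ∣ ≤ ∣ i ℤ.- j ∣ + ∣ j ℤ.- k ∣
  ∣i-k∣≤∣i-j∣+∣j-k∣ i j k =
    subst (λ t → ∣ t ∣ ≤ ∣ i ℤ.- j ∣ + ∣ j ℤ.- k ∣) (split i j k) (ℤₚ.∣i+j∣≤∣i∣+∣j∣ (i ℤ.- j) (j ℤ.- k))
    where
    split : ∀ i j k → (i ℤ.- j) ℤ.+ (j ℤ.- k) ≡ i ℤ.- k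
    split = solve-∀

  ∣Δx∣≤d⋆ : ∀ x y x' y' → ∣ x ℤ.- x' ∣ ≤ d⋆ (x , y) (x' , y')
  ∣Δx∣≤d⋆ x y x' y' = m≤m⊔n ∣ x ℤ.- x' ∣ ∣ y ℤ.- y' ∣

  ∣Δy∣≤d⋆ : ∀ x y x' y' → ∣ y ℤ.- y' ∣ ≤ d⋆ (x , y) (x' , y')
  ∣Δy∣≤d⋆ x y x' y' = m≤n⊔m ∣ x ℤ.- x' ∣ ∣ y ℤ.- y' ∣

  d⋆≡0⇒≡ : ∀ z w → d⋆ z w ≡ 0 → z ≡ w
  d⋆≡0⇒≡ (x , y) (x' , y') d≡0 = cong₂ _,_
    (ℤₚ.i-j≡0⇒i≡j x x' (ℤₚ.∣i∣≡0⇒i≡0 (n≤0⇒n≡0 (subst (∣ x ℤ.- x' ∣ ≤_) d≡0 (∣Δx∣≤d⋆ x y x' y')))))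
    (ℤₚ.i-j≡0⇒i≡j y y' (ℤₚ.∣i∣≡0⇒i≡0 (n≤0⇒n≡0 (subst (∣ y ℤ.- y' ∣ ≤_) d≡0 (∣Δy∣≤d⋆ x y x' y')))))

  d⋆-triangle : ∀ z w v → d⋆ z v ≤ d⋆ z w + d⋆ w v
  d⋆-triangle (x , y) (x' , y') (x'' , y'') = ⊔-lub
    (≤-trans (∣i-k∣≤∣i-j∣+∣j-k∣ x x' x'') (+-mono-≤ (∣Δx∣≤d⋆ x y x' y') (∣Δx∣≤d⋆ x' y' x'' y'')))
    (≤-trans (∣i-k∣≤∣i-j∣+∣j-k∣ y y' y'') (+-mono-≤ (∣Δy∣≤d⋆ x y x' y') (∣Δy∣≤d⋆ x' y' x'' y'')))

  signum : ℤ → ℤ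
  signum (+ zero)  = 0ℤ
  signum (+ suc _) = 1ℤ
  signum -[1+ _ ]  = -1ℤ

  ∣signum-i∣ : ∀ i → ∣ signum i ∣ ≡ 1 ⊓ ∣ i ∣
  ∣signum-i∣ (+ zero)  = refl
  ∣signum-i∣ (+ suc _) = refl
  ∣signum-i∣ -[1+ _ ]  = refl

  ∣i-signum-i∣ : ∀ i → ∣ i ℤ.- signum i ∣ ≡ ∣ i ∣ ∸ 1
  ∣i-signum-i∣ (+ zero)       = refl
  ∣i-signum-i∣ (+ suc _)      = refl
  ∣i-signum-i∣ -[1+ zero ]    = refl
  ∣i-signum-i∣ -[1+ suc _ ]   = refl

  stepToward : ℤ² → ℤ² → ℤ²
  stepToward (x , y) (x' , y') = x ℤ.- signum (x ℤ.- x') , y ℤ.- signum (y ℤ.- y')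

  stepToward-adj : ∀ z w {n} → d⋆ z w ≡ suc n → Adj z (stepToward z w)
  stepToward-adj (x , y) (x' , y') {n} d≡1+n = begin
    ∣ x ℤ.- (x ℤ.- signum Δx) ∣ ⊔ ∣ y ℤ.- (y ℤ.- signum Δy) ∣
      ≡⟨ cong₂ _⊔_ (cong ∣_∣ (cancel x (signum Δx))) (cong ∣_∣ (cancel y (signum Δy))) ⟩
    ∣ signum Δx ∣ ⊔ ∣ signum Δy ∣
      ≡⟨ cong₂ _⊔_ (∣signum-i∣ Δx) (∣signum-i∣ Δy) ⟩
    (1 ⊓ ∣ Δx ∣) ⊔ (1 ⊓ ∣ Δy ∣)
      ≡⟨ ⊓-distribˡ-⊔ 1 ∣ Δx ∣ ∣ Δy ∣ ⟨
    1 ⊓ d⋆ (x , y) (x' , y')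
      ≡⟨ cong (1 ⊓_) d≡1+n ⟩
    1 ⊓ suc n
      ∎
    where
    open ≡-Reasoning
    Δx = x ℤ.- x'
    Δy = y ℤ.- y'
    cancel : ∀ a s → a ℤ.- (a ℤ.- s) ≡ s
    cancel = solve-∀

  stepToward-closer : ∀ z w {n} → d⋆ z w ≡ suc n → d⋆ (stepToward z w) w ≡ n
  stepToward-closer (x , y) (x' , y') {n} d≡1+n = begin
    ∣ (x ℤ.- signum Δx) ℤ.- x' ∣ ⊔ ∣ (y ℤ.- signum Δy) ℤ.- y' ∣
      ≡⟨ cong₂ _⊔_ (cong ∣_∣ (reorder x x' (signum Δx))) (cong ∣_∣ (reorder y y' (signum Δy))) ⟩
    ∣ Δx ℤ.- signum Δx ∣ ⊔ ∣ Δy ℤ.- signum Δy ∣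
      ≡⟨ cong₂ _⊔_ (∣i-signum-i∣ Δx) (∣i-signum-i∣ Δy) ⟩
    (∣ Δx ∣ ∸ 1) ⊔ (∣ Δy ∣ ∸ 1)
      ≡⟨ ∸-distribʳ-⊔ 1 ∣ Δx ∣ ∣ Δy ∣ ⟨
    d⋆ (x , y) (x' , y') ∸ 1
      ≡⟨ cong (_∸ 1) d≡1+n ⟩
    n
      ∎
    where
    open ≡-Reasoning
    Δx = x ℤ.- x'
    Δy = y ℤ.- y'
    reorder : ∀ a b s → (a ℤ.- s) ℤ.- b ≡ (a ℤ.- b) ℤ.- s
    reorder = solve-∀

  record Extension (V : List ℤ²) (bound : ℕ) (w : ℤ²) : Set where
    constructor extension
    field
      {vertices} : List ℤ²
      {edges}    : ℕ
      tree       : TreeIn vertices edges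
      edges≤     : edges ≤ bound
      V⊆         : V ⊆ vertices
      w∈         : w ∈ vertices

  extendTo : ∀ n {V k u} → TreeIn V k → ∀ w → u ∈ V → d⋆ u w ≡ n → Extension V (k + n) w
  extendTo zero {V} {k} T w u∈ d≡0 =
    extension T (≤-reflexive (sym (+-identityʳ k))) id (subst (_∈ V) (d⋆≡0⇒≡ _ w d≡0) u∈)
  extendTo (suc n) {V} {k} {u} T w u∈ d≡1+n with stepToward u w ∈? V
  ... | yes v∈ =
    let extension T' e≤ V⊆ w∈ = extendTo n T w v∈ closer
    in  extension T' (≤-trans e≤ (+-monoʳ-≤ k (n≤1+n n))) V⊆ w∈
    where closer = stepToward-closer u w d≡1+n
  ... | no v∉ =
    let extension T' e≤ V⊆ w∈ = extendTo n (grow T u _ u∈ v∉ (stepToward-adj u w d≡1+n)) w (here refl) closer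
    in  extension T' (≤-trans e≤ (≤-reflexive (sym (+-suc k n)))) (V⊆ ∘ there) w∈
    where closer = stepToward-closer u w d≡1+n

  starLength : ℤ² → ℤ² → ℤ² → ℤ² → ℕ
  starLength m a b c = d⋆ m a + d⋆ m b + d⋆ m c

  star⇒tristance : ∀ m {a b c d} → starLength m a b c ≤ d → Tristance≤ d a b c
  star⇒tristance m {a} {b} {c} star≤d =
    let extension T₁ e₁≤ V₁⊆ a∈ = extendTo (d⋆ m a) (single m) a (here refl) refl
        extension T₂ e₂≤ V₂⊆ b∈ = extendTo (d⋆ m b) T₁ b (V₁⊆ (here refl)) refl
        extension T₃ e₃≤ V₃⊆ c∈ = extendTo (d⋆ m c) T₂ c (V₂⊆ (V₁⊆ (here refl))) refl
        e₃≤star = ≤-trans e₃≤ (+-monoˡ-≤ (d⋆ m c) (≤-trans e₂≤ (+-monoˡ-≤ (d⋆ m b) e₁≤)))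
    in  _ , _ , T₃ , ≤-trans e₃≤star star≤d , V₃⊆ (V₂⊆ a∈) , V₃⊆ b∈ , c∈

  d⋆-adj : ∀ {u v} → Adj u v → ∀ w → d⋆ w v ≤ suc (d⋆ w u)
  d⋆-adj {u} {v} u~v w =
    ≤-trans (d⋆-triangle w u v) (≤-reflexive (trans (cong (λ t → d⋆ w u + t) u~v) (+-comm (d⋆ w u) 1)))

  tree-diameter : ∀ {V k a b} → TreeIn V k → a ∈ V → b ∈ V → d⋆ a b ≤ k
  tree-diameter (single v) (here refl) (here refl) = ≤-reflexive (d⋆-self v)
  tree-diameter (grow T u v u∈ _ u~v) (here refl) (here refl) =
    subst (_≤ _) (sym (d⋆-self v)) z≤n
  tree-diameter {b = b} (grow T u v u∈ _ u~v) (here refl) (there b∈) =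
    subst (_≤ _) (d⋆-sym b v) (≤-trans (d⋆-adj u~v b) (s≤s (tree-diameter T b∈ u∈)))
  tree-diameter {a = a} (grow T u v u∈ _ u~v) (there a∈) (here refl) =
    ≤-trans (d⋆-adj u~v a) (s≤s (tree-diameter T a∈ u∈))
  tree-diameter (grow T u v u∈ _ u~v) (there a∈) (there b∈) =
    m≤n⇒m≤1+n (tree-diameter T a∈ b∈)

  module _ {k : ℕ} {a b c : ℤ²} where

    star-swap₁₂ : ∃[ m ] starLength m a b c ≤ k → ∃[ m ] starLength m b a c ≤ k
    star-swap₁₂ (m , star≤k) = m , subst (_≤ k) (swap (d⋆ m a) (d⋆ m b) (d⋆ m c)) star≤k
      where
      swap : ∀ x y z → x + y + z ≡ y + x + z
      swap = ℕ-Solver.solve-∀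

    star-swap₁₃ : ∃[ m ] starLength m a b c ≤ k → ∃[ m ] starLength m c b a ≤ k
    star-swap₁₃ (m , star≤k) = m , subst (_≤ k) (swap (d⋆ m a) (d⋆ m b) (d⋆ m c)) star≤k
      where
      swap : ∀ x y z → x + y + z ≡ z + y + x
      swap = ℕ-Solver.solve-∀

    star-swap₂₃ : ∃[ m ] starLength m a b c ≤ k → ∃[ m ] starLength m a c b ≤ k
    star-swap₂₃ (m , star≤k) = m , subst (_≤ k) (swap (d⋆ m a) (d⋆ m b) (d⋆ m c)) star≤k
      where
      swap : ∀ x y z → x + y + z ≡ x + z + y
      swap = ℕ-Solver.solve-∀

    star-adj : ∀ {v} → Adj a v → ∃[ m ] starLength m a b c ≤ k → ∃[ m ] starLength m v b c ≤ suc k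
    star-adj a~v (m , star≤k) =
      m , ≤-trans (+-monoˡ-≤ (d⋆ m c) (+-monoˡ-≤ (d⋆ m b) (d⋆-adj a~v m))) (s≤s star≤k)

  star-of-repeated-point : ∀ {V k v c} → TreeIn V k → v ∈ V → c ∈ V → ∃[ m ] starLength m v v c ≤ k
  star-of-repeated-point {k = k} {v} {c} T v∈ c∈ =
    v , subst (λ t → t + t + d⋆ v c ≤ k) (sym (d⋆-self v)) (tree-diameter T v∈ c∈)

  tree⇒star : ∀ {V k a b c} → TreeIn V k → a ∈ V → b ∈ V → c ∈ V → ∃[ m ] starLength m a b c ≤ k
  tree⇒star T (here refl) (here refl) c∈ = star-of-repeated-point T (here refl) c∈
  tree⇒star T (here refl) (there b∈) (here refl) = star-swap₂₃ (star-of-repeated-point T (here refl) (there b∈))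
  tree⇒star T (there a∈) (here refl) (here refl) = star-swap₁₃ (star-of-repeated-point T (here refl) (there a∈))
  tree⇒star (grow T u v u∈ _ u~v) (here refl) (there b∈) (there c∈) =
    star-adj u~v (tree⇒star T u∈ b∈ c∈)
  tree⇒star (grow T u v u∈ _ u~v) (there a∈) (here refl) (there c∈) =
    star-swap₁₂ (star-adj u~v (tree⇒star T u∈ a∈ c∈))
  tree⇒star (grow T u v u∈ _ u~v) (there a∈) (there b∈) (here refl) =
    star-swap₁₃ (star-adj u~v (tree⇒star T u∈ b∈ a∈))
  tree⇒star (grow T u v u∈ _ u~v) (there a∈) (there b∈) (there c∈) =
    map₂ m≤n⇒m≤1+n (tree⇒star T a∈ b∈ c∈)

  tristance⇔star : ∀ d a b c → Tristance≤ d a b c ⇔ (∃[ m ] starLength m a b c ≤ d)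
  tristance⇔star d a b c = mk⇔
    (λ (_ , _ , T , k≤d , a∈ , b∈ , c∈) → map₂ (λ star≤k → ≤-trans star≤k k≤d) (tree⇒star T a∈ b∈ c∈))
    (λ (m , star≤d) → star⇒tristance m star≤d)

module Region where

  open Steiner using (starLength; ∣Δx∣≤d⋆; ∣Δy∣≤d⋆)
  import Data.Nat as ℕ
  import Data.Nat.Properties as ℕₚ
  open import Data.Integer
  open import Data.Integer.Properties
  open import Data.Integer.Tactic.RingSolver using (solve; solve-∀)
  open import Data.List using (_∷_; [])
  open import Data.List.Relation.Unary.All as All using (All; _∷_; [])
  open import Data.Product using (_×_; _,_; ∃-syntax)
  open import Data.Sum using (inj₁; inj₂)
  open import Function.Bundles using (_⇔_; mk⇔)
  open import Relation.Binary.PropositionalEquality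

  infixr 6 _⊕_

  _⊕_ : ∀ {a b c d} → a ≤ b → c ≤ d → a + c ≤ b + d
  _⊕_ = +-mono-≤

  ≤-by-gap : ∀ {a b l r} → l ≤ r → r - l ≡ b - a → a ≤ b
  ≤-by-gap l≤r gap = 0≤i-j⇒j≤i (subst (0ℤ ≤_) gap (i≤j⇒0≤j-i l≤r))

  ≤-by-double-gap : ∀ {a b l r} → l ≤ r → r - l ≡ + 2 * (b - a) → a ≤ b
  ≤-by-double-gap {a} {b} l≤r gap = 0≤i-j⇒j≤i (halve (b - a) (subst (0ℤ ≤_) gap (i≤j⇒0≤j-i l≤r)))
    where
    halve : ∀ i → 0ℤ ≤ + 2 * i → 0ℤ ≤ i
    halve (+ _)    _  = +≤+ ℕ.z≤n
    halve -[1+ _ ] ()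

  i≤+∣i∣ : ∀ i → i ≤ + ∣ i ∣
  i≤+∣i∣ (+ _)    = ≤-refl
  i≤+∣i∣ -[1+ _ ] = -≤+

  i-j≤+n : ∀ i j {n} → ∣ i - j ∣ ℕ.≤ n → i - j ≤ + n
  i-j≤+n i j ∣i-j∣≤n = ≤-trans (i≤+∣i∣ (i - j)) (+≤+ ∣i-j∣≤n)

  j-i≤+n : ∀ i j {n} → ∣ i - j ∣ ℕ.≤ n → j - i ≤ + n
  j-i≤+n i j {n} ∣i-j∣≤n = i-j≤+n j i (subst (ℕ._≤ n) (∣i-j∣≡∣j-i∣ i j) ∣i-j∣≤n)

  +∣i-j∣≤ : ∀ i j {r} → i - j ≤ r → j - i ≤ r → + ∣ i - j ∣ ≤ r
  +∣i-j∣≤ i j i-j≤r j-i≤r with +∣i∣≡i⊎+∣i∣≡-i (i - j)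
  ... | inj₁ ∣i-j∣≡i-j = subst (_≤ _) (sym ∣i-j∣≡i-j) i-j≤r
  ... | inj₂ ∣i-j∣≡j-i = subst (_≤ _) (sym (trans ∣i-j∣≡j-i (negate i j))) j-i≤r
    where
    negate : ∀ i j → - (i - j) ≡ j - i
    negate = solve-∀

  +m⊔n≤ : ∀ {m n r} → + m ≤ r → + n ≤ r → + (m ℕ.⊔ n) ≤ r
  +m⊔n≤ (+≤+ m≤r) (+≤+ n≤r) = +≤+ (ℕₚ.⊔-lub m≤r n≤r)

  WithinSquare : ℤ → ℤ² → ℤ² → Set
  WithinSquare r (p , q) (x , y) = (p - x ≤ r × x - p ≤ r) × (q - y ≤ r × y - q ≤ r)

  withinSquare-d⋆ : ∀ m w → WithinSquare (+ d⋆ m w) m w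
  withinSquare-d⋆ (p , q) (x , y) =
    (i-j≤+n p x Δx≤d⋆ , j-i≤+n p x Δx≤d⋆) , (i-j≤+n q y Δy≤d⋆ , j-i≤+n q y Δy≤d⋆)
    where
    Δx≤d⋆ = ∣Δx∣≤d⋆ p q x y
    Δy≤d⋆ = ∣Δy∣≤d⋆ p q x y

  withinSquare⇒d⋆≤ : ∀ {r} m w → WithinSquare r m w → + d⋆ m w ≤ r
  withinSquare⇒d⋆≤ (p , q) (x , y) ((p-x≤r , x-p≤r) , (q-y≤r , y-q≤r)) =
    +m⊔n≤ (+∣i-j∣≤ p x p-x≤r x-p≤r) (+∣i-j∣≤ q y q-y≤r y-q≤r)

  Octagon : ℤ² → ℤ² → ℤ → ℤ² → Set
  Octagon (x₁ , y₁) (x₂ , y₂) c (x , y) =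
    (x₁ - c ≤ x × x ≤ x₂ + c)
    × (x₁ + y₁ - + 2 * c ≤ x + y × x + y ≤ x₂ + y₂ + + 2 * c)
    × (x₁ - y₁ - + 2 * c ≤ x - y × x - y ≤ x₂ - y₂ + + 2 * c)
    × ((x₁ + y₁) - (x₂ - y₂) - + 2 * c ≤ + 2 * y × + 2 * y ≤ (x₂ + y₂) - (x₁ - y₁) + + 2 * c)

  octagon-from-squares : ∀ {x₁ y₁ x₂ y₂ c} z m {r₁ r₂ r₃} → 0ℤ ≤ r₁ → 0ℤ ≤ r₂ →
    WithinSquare r₁ m (x₁ , y₁) → WithinSquare r₂ m (x₂ , y₂) → WithinSquare r₃ m z →
    r₁ + r₂ + r₃ ≤ c + (x₂ - x₁) → Octagon (x₁ , y₁) (x₂ , y₂) c z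
  -- Wᵢ, Eᵢ, Sᵢ, Nᵢ bound how far zᵢ lies west, east, south and north of m.
  octagon-from-squares {x₁} {y₁} {x₂} {y₂} {c} (x , y) (p , q) {r₁} {r₂} {r₃} 0≤r₁ 0≤r₂
    ((W₁ , E₁) , (S₁ , N₁)) ((W₂ , E₂) , (S₂ , N₂)) ((W₃ , E₃) , (S₃ , N₃)) Σr≤ =
    ( ≤-by-gap (E₂ ⊕ W₃ ⊕ 0≤r₁ ⊕ Σr≤) (solve atoms)
    , ≤-by-gap (E₃ ⊕ W₁ ⊕ 0≤r₂ ⊕ Σr≤) (solve atoms) )
    , ( ≤-by-gap (E₂ ⊕ E₂ ⊕ W₁ ⊕ N₁ ⊕ W₃ ⊕ S₃ ⊕ Σr≤ ⊕ Σr≤) (solve atoms)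
      , ≤-by-gap (W₁ ⊕ W₁ ⊕ E₂ ⊕ S₂ ⊕ E₃ ⊕ N₃ ⊕ Σr≤ ⊕ Σr≤) (solve atoms) )
    , ( ≤-by-gap (E₂ ⊕ E₂ ⊕ W₁ ⊕ S₁ ⊕ W₃ ⊕ N₃ ⊕ Σr≤ ⊕ Σr≤) (solve atoms)
      , ≤-by-gap (W₁ ⊕ W₁ ⊕ E₂ ⊕ N₂ ⊕ E₃ ⊕ S₃ ⊕ Σr≤ ⊕ Σr≤) (solve atoms) )
    , ( ≤-by-gap (W₁ ⊕ N₁ ⊕ E₂ ⊕ N₂ ⊕ S₃ ⊕ S₃ ⊕ Σr≤ ⊕ Σr≤) (solve atoms)
      , ≤-by-gap (W₁ ⊕ S₁ ⊕ E₂ ⊕ S₂ ⊕ N₃ ⊕ N₃ ⊕ Σr≤ ⊕ Σr≤) (solve atoms) )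
    where atoms = x₁ ∷ y₁ ∷ x₂ ∷ y₂ ∷ c ∷ x ∷ y ∷ p ∷ q ∷ r₁ ∷ r₂ ∷ r₃ ∷ []

  +starLength : ∀ m a b c → + starLength m a b c ≡ + d⋆ m a + + d⋆ m b + + d⋆ m c
  +starLength m a b c =
    trans (pos-+ (d⋆ m a ℕ.+ d⋆ m b) (d⋆ m c)) (cong (_+ + d⋆ m c) (pos-+ (d⋆ m a) (d⋆ m b)))

  octagon-necessary : ∀ {x₁ y₁ x₂ y₂ c} z m →
    + starLength m (x₁ , y₁) (x₂ , y₂) z ≤ c + (x₂ - x₁) → Octagon (x₁ , y₁) (x₂ , y₂) c z
  octagon-necessary {x₁} {y₁} {x₂} {y₂} {c} z m star≤ =
    octagon-from-squares z m (+≤+ ℕ.z≤n) (+≤+ ℕ.z≤n)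
      (withinSquare-d⋆ m (x₁ , y₁)) (withinSquare-d⋆ m (x₂ , y₂)) (withinSquare-d⋆ m z)
      (subst (_≤ c + (x₂ - x₁)) (+starLength m (x₁ , y₁) (x₂ , y₂) z) star≤)

  ∃-between : ∀ l ls us → All (λ a → All (a ≤_) us) (l ∷ ls) →
    ∃[ t ] All (_≤ t) (l ∷ ls) × All (t ≤_) us
  ∃-between l [] us (l≤us ∷ []) = l , ≤-refl ∷ [] , l≤us
  ∃-between l (a ∷ ls) us (l≤us ∷ a≤us ∷ ls≤us) with ∃-between l ls us (l≤us ∷ ls≤us)
  ... | t , l≤t ∷ ls≤t , t≤us =
    a ⊔ t , raise l≤t ∷ i≤i⊔j a t ∷ All.map raise ls≤t
          , All.zipWith (λ (a≤u , t≤u) → ⊔-lub a≤u t≤u) (a≤us , t≤us)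
    where
    raise : ∀ {b} → b ≤ t → b ≤ a ⊔ t
    raise b≤t = ≤-trans b≤t (i≤j⊔i a t)

  abscissa : ∀ {x₁ y₁ x₂ y₂ c} x y → 0ℤ ≤ c → y₂ - y₁ ≤ x₂ - x₁ → y₁ - y₂ ≤ x₂ - x₁ →
    Octagon (x₁ , y₁) (x₂ , y₂) c (x , y) →
    ∃[ p ] All (_≤ p) (x₁ ∷ x - c ∷ y - c + (x₁ - y₁) ∷ (x₁ + y₁) - y - c ∷ [])
         × All (p ≤_) (x₂ ∷ x + c ∷ (x₂ + y₂) - y + c ∷ (x₂ - y₂) + y + c ∷ [])
  abscissa {x₁} {y₁} {x₂} {y₂} {c} x y 0≤c y₂-y₁≤ y₁-y₂≤
    ((x≥ , x≤) , (x+y≥ , x+y≤) , (x-y≥ , x-y≤) , (2y≥ , 2y≤)) =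
    ∃-between x₁ (x - c ∷ y - c + (x₁ - y₁) ∷ (x₁ + y₁) - y - c ∷ [])
                 (x₂ ∷ x + c ∷ (x₂ + y₂) - y + c ∷ (x₂ - y₂) + y + c ∷ [])
      ( (≤-by-double-gap (y₂-y₁≤ ⊕ y₁-y₂≤) (solve atoms) ∷ ≤-by-gap x≥ (solve atoms)
        ∷ ≤-by-double-gap (2y≤ ⊕ y₁-y₂≤) (solve atoms) ∷ ≤-by-double-gap (2y≥ ⊕ y₂-y₁≤) (solve atoms) ∷ [])
      ∷ (≤-by-gap x≤ (solve atoms) ∷ ≤-by-gap (0≤c ⊕ 0≤c) (solve atoms)
        ∷ ≤-by-gap x+y≤ (solve atoms) ∷ ≤-by-gap x-y≤ (solve atoms) ∷ [])
      ∷ (≤-by-double-gap (2y≤ ⊕ y₂-y₁≤) (solve atoms) ∷ ≤-by-gap x-y≥ (solve atoms)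
        ∷ ≤-by-gap 2y≤ (solve atoms) ∷ ≤-by-gap (y₂-y₁≤ ⊕ 0≤c ⊕ 0≤c) (solve atoms) ∷ [])
      ∷ (≤-by-double-gap (2y≥ ⊕ y₁-y₂≤) (solve atoms) ∷ ≤-by-gap x+y≥ (solve atoms)
        ∷ ≤-by-gap (y₁-y₂≤ ⊕ 0≤c ⊕ 0≤c) (solve atoms) ∷ ≤-by-gap 2y≥ (solve atoms) ∷ [])
      ∷ [] )
    where atoms = x₁ ∷ y₁ ∷ x₂ ∷ y₂ ∷ c ∷ x ∷ y ∷ []

  ordinate : ∀ {x₁ y₁ x₂ y₂ c} x y p → 0ℤ ≤ c → y₂ - y₁ ≤ x₂ - x₁ → y₁ - y₂ ≤ x₂ - x₁ →
    All (_≤ p) (x₁ ∷ x - c ∷ y - c + (x₁ - y₁) ∷ (x₁ + y₁) - y - c ∷ []) →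
    All (p ≤_) (x₂ ∷ x + c ∷ (x₂ + y₂) - y + c ∷ (x₂ - y₂) + y + c ∷ []) →
    ∃[ q ] All (_≤ q) (y - c ∷ (x₁ + y₁) - p ∷ p - (x₂ - y₂) ∷ [])
         × All (q ≤_) (y + c ∷ (x₂ + y₂) - p ∷ p - (x₁ - y₁) ∷ [])
  ordinate {x₁} {y₁} {x₂} {y₂} {c} x y p 0≤c y₂-y₁≤ y₁-y₂≤
    (p≥x₁ ∷ _ ∷ p≥y-c+x₁-y₁ ∷ p≥x₁+y₁-y-c ∷ []) (p≤x₂ ∷ _ ∷ p≤x₂+y₂-y+c ∷ p≤x₂-y₂+y+c ∷ []) =
    ∃-between (y - c) ((x₁ + y₁) - p ∷ p - (x₂ - y₂) ∷ []) (y + c ∷ (x₂ + y₂) - p ∷ p - (x₁ - y₁) ∷ [])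
      ( (≤-by-gap (0≤c ⊕ 0≤c) (solve atoms) ∷ ≤-by-gap p≤x₂+y₂-y+c (solve atoms)
        ∷ ≤-by-gap p≥y-c+x₁-y₁ (solve atoms) ∷ [])
      ∷ (≤-by-gap p≥x₁+y₁-y-c (solve atoms) ∷ ≤-by-gap y₁-y₂≤ (solve atoms)
        ∷ ≤-by-gap (p≥x₁ ⊕ p≥x₁) (solve atoms) ∷ [])
      ∷ (≤-by-gap p≤x₂-y₂+y+c (solve atoms) ∷ ≤-by-gap (p≤x₂ ⊕ p≤x₂) (solve atoms)
        ∷ ≤-by-gap y₂-y₁≤ (solve atoms) ∷ [])
      ∷ [] )
    where atoms = x₁ ∷ y₁ ∷ x₂ ∷ y₂ ∷ c ∷ x ∷ y ∷ p ∷ []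

  star-bound : ∀ {x₁ y₁ x₂ y₂ c} x y p q →
    All (_≤ p) (x₁ ∷ x - c ∷ y - c + (x₁ - y₁) ∷ (x₁ + y₁) - y - c ∷ []) →
    All (p ≤_) (x₂ ∷ x + c ∷ (x₂ + y₂) - y + c ∷ (x₂ - y₂) + y + c ∷ []) →
    All (_≤ q) (y - c ∷ (x₁ + y₁) - p ∷ p - (x₂ - y₂) ∷ []) →
    All (q ≤_) (y + c ∷ (x₂ + y₂) - p ∷ p - (x₁ - y₁) ∷ []) →
    + starLength (p , q) (x₁ , y₁) (x₂ , y₂) (x , y) ≤ c + (x₂ - x₁)
  star-bound {x₁} {y₁} {x₂} {y₂} {c} x y p q (p≥x₁ ∷ p≥x-c ∷ _) (p≤x₂ ∷ p≤x+c ∷ _)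
    (q≥y-c ∷ q≥x₁+y₁-p ∷ q≥p-x₂+y₂ ∷ []) (q≤y+c ∷ q≤x₂+y₂-p ∷ q≤p-x₁+y₁ ∷ []) =
    begin
      + starLength m (x₁ , y₁) (x₂ , y₂) (x , y)
        ≡⟨ +starLength m (x₁ , y₁) (x₂ , y₂) (x , y) ⟩
      + d⋆ m (x₁ , y₁) + + d⋆ m (x₂ , y₂) + + d⋆ m (x , y)
        ≤⟨ (withinSquare⇒d⋆≤ m _ square₁ ⊕ withinSquare⇒d⋆≤ m _ square₂) ⊕ withinSquare⇒d⋆≤ m _ square₃ ⟩
      (p - x₁) + (x₂ - p) + c
        ≡⟨ solve atoms ⟩
      c + (x₂ - x₁)
        ∎
    where
    open ≤-Reasoning
    m = p , q
    atoms = x₁ ∷ y₁ ∷ x₂ ∷ y₂ ∷ c ∷ x ∷ y ∷ p ∷ q ∷ []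
    square₁ : WithinSquare (p - x₁) (p , q) (x₁ , y₁)
    square₁ = (≤-refl , ≤-by-gap (p≥x₁ ⊕ p≥x₁) (solve atoms))
            , (≤-by-gap q≤p-x₁+y₁ (solve atoms) , ≤-by-gap q≥x₁+y₁-p (solve atoms))
    square₂ : WithinSquare (x₂ - p) (p , q) (x₂ , y₂)
    square₂ = (≤-by-gap (p≤x₂ ⊕ p≤x₂) (solve atoms) , ≤-refl)
            , (≤-by-gap q≤x₂+y₂-p (solve atoms) , ≤-by-gap q≥p-x₂+y₂ (solve atoms))
    square₃ : WithinSquare c (p , q) (x , y)
    square₃ = (≤-by-gap p≤x+c (solve atoms) , ≤-by-gap p≥x-c (solve atoms))
            , (≤-by-gap q≤y+c (solve atoms) , ≤-by-gap q≥y-c (solve atoms))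

  octagon-sufficient : ∀ {x₁ y₁ x₂ y₂ c} z → 0ℤ ≤ c → + ∣ y₂ - y₁ ∣ ≤ x₂ - x₁ →
    Octagon (x₁ , y₁) (x₂ , y₂) c z → ∃[ m ] + starLength m (x₁ , y₁) (x₂ , y₂) z ≤ c + (x₂ - x₁)
  octagon-sufficient {x₁} {y₁} {x₂} {y₂} (x , y) 0≤c ∣Δy∣≤Δx oct =
    let p , p-lower , p-upper = abscissa x y 0≤c y₂-y₁≤ y₁-y₂≤ oct
        q , q-lower , q-upper = ordinate x y p 0≤c y₂-y₁≤ y₁-y₂≤ p-lower p-upper
    in  (p , q) , star-bound x y p q p-lower p-upper q-lower q-upper
    where
    y₂-y₁≤ : y₂ - y₁ ≤ x₂ - x₁
    y₂-y₁≤ = ≤-trans (i-j≤+n y₂ y₁ ℕₚ.≤-refl) ∣Δy∣≤Δx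
    y₁-y₂≤ : y₁ - y₂ ≤ x₂ - x₁
    y₁-y₂≤ = ≤-trans (j-i≤+n y₂ y₁ ℕₚ.≤-refl) ∣Δy∣≤Δx

  centre⇔octagon : ∀ {x₁ y₁ x₂ y₂ c} z → 0ℤ ≤ c → + ∣ y₂ - y₁ ∣ ≤ x₂ - x₁ →
    (∃[ m ] + starLength m (x₁ , y₁) (x₂ , y₂) z ≤ c + (x₂ - x₁)) ⇔ Octagon (x₁ , y₁) (x₂ , y₂) c z
  centre⇔octagon z 0≤c ∣Δy∣≤Δx =
    mk⇔ (λ (m , star≤) → octagon-necessary z m star≤) (octagon-sufficient z 0≤c ∣Δy∣≤Δx)

  d⋆-horizontal : ∀ x₁ y₁ x₂ y₂ → + ∣ y₂ - y₁ ∣ ≤ x₂ - x₁ → + d⋆ (x₁ , y₁) (x₂ , y₂) ≡ x₂ - x₁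
  d⋆-horizontal x₁ y₁ x₂ y₂ ∣Δy∣≤Δx = begin
    + (∣ x₁ - x₂ ∣ ℕ.⊔ ∣ y₁ - y₂ ∣) ≡⟨ cong +_ (ℕₚ.m≥n⇒m⊔n≡m ∣Δy∣≤∣Δx∣) ⟩
    + ∣ x₁ - x₂ ∣                   ≡⟨ ∣-∣-≤ x₁≤x₂ ⟩
    x₂ - x₁                         ∎
    where
    open ≡-Reasoning
    x₁≤x₂ : x₁ ≤ x₂
    x₁≤x₂ = 0≤i-j⇒j≤i (≤-trans (+≤+ ℕ.z≤n) ∣Δy∣≤Δx)
    ∣Δy∣≤∣Δx∣ : ∣ y₁ - y₂ ∣ ℕ.≤ ∣ x₁ - x₂ ∣
    ∣Δy∣≤∣Δx∣ = drop‿+≤+ (subst₂ _≤_ (cong +_ (∣i-j∣≡∣j-i∣ y₂ y₁)) (sym (∣-∣-≤ x₁≤x₂)) ∣Δy∣≤Δx)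

open import Data.Nat using (ℕ; _∸_)
open import Data.Integer using (ℤ; +_; _+_; _-_; _*_; _≤_; ∣_∣)
open import Data.Product using (_×_; _,_)
open import Function.Bundles using (_⇔_)
open import Relation.Binary.PropositionalEquality using (_≢_)
import Data.Nat as N

open import Data.Integer using (+≤+)
open import Data.Integer.Properties using (pos-+; drop‿+≤+)
open import Data.Nat.Properties using (m∸n+n≡m)
open import Data.Product using (∃-syntax; map₂)
open import Function.Bundles using (mk⇔)
import Function.Properties.Equivalence as ⇔
open import Relation.Binary.PropositionalEquality using (_≡_; cong; sym; subst; module ≡-Reasoning)
open Steiner using (starLength; tristance⇔star)
open Region using (d⋆-horizontal; centre⇔octagon)

theorem17 : (x₁ y₁ x₂ y₂ : ℤ) → (x₁ , y₁) ≢ (x₂ , y₂) → + ∣ y₂ - y₁ ∣ ≤ x₂ - x₁ →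
    (d : ℕ) → d⋆ (x₁ , y₁) (x₂ , y₂) N.≤ d →
    let c = + (d ∸ d⋆ (x₁ , y₁) (x₂ , y₂)) in
    (∀ (x y : ℤ) →
      Tristance≤ d (x₁ , y₁) (x₂ , y₂) (x , y)
      ⇔ ((x₁ - c ≤ x × x ≤ x₂ + c)
        × (x₁ + y₁ - + 2 * c ≤ x + y × x + y ≤ x₂ + y₂ + + 2 * c)
        × (x₁ - y₁ - + 2 * c ≤ x - y × x - y ≤ x₂ - y₂ + + 2 * c)
        × ((x₁ + y₁) - (x₂ - y₂) - + 2 * c ≤ + 2 * y
           × + 2 * y ≤ (x₂ + y₂) - (x₁ - y₁) + + 2 * c)))
-- The result holds for z₁ = z₂ as well.
theorem17 x₁ y₁ x₂ y₂ _ ∣Δy∣≤Δx d dist≤d x y =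
  ⇔.trans (tristance⇔star d z₁ z₂ z) (⇔.trans stars-in-ℤ (centre⇔octagon z (+≤+ N.z≤n) ∣Δy∣≤Δx))
  where
  z₁ = x₁ , y₁
  z₂ = x₂ , y₂
  z = x , y
  dist = d⋆ z₁ z₂
  c = + (d ∸ dist)
  d≡c+Δx : + d ≡ c + (x₂ - x₁)
  d≡c+Δx = begin
    + d                   ≡⟨ cong +_ (m∸n+n≡m dist≤d) ⟨
    + (d ∸ dist N.+ dist) ≡⟨ pos-+ (d ∸ dist) dist ⟩
    c + + dist            ≡⟨ cong (λ t → c + t) (d⋆-horizontal x₁ y₁ x₂ y₂ ∣Δy∣≤Δx) ⟩
    c + (x₂ - x₁)         ∎
    where open ≡-Reasoning
  stars-in-ℤ : (∃[ m ] starLength m z₁ z₂ z N.≤ d) ⇔ (∃[ m ] + starLength m z₁ z₂ z ≤ c + (x₂ - x₁))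
  stars-in-ℤ = mk⇔ (map₂ lift) (map₂ unlift)
    where
    lift : ∀ {n} → n N.≤ d → + n ≤ c + (x₂ - x₁)
    lift {n} n≤d = subst (+ n ≤_) d≡c+Δx (+≤+ n≤d)
    unlift : ∀ {n} → + n ≤ c + (x₂ - x₁) → n N.≤ d
    unlift {n} n≤ = drop‿+≤+ (subst (+ n ≤_) (sym d≡c+Δx) n≤)
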